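{- Let $n$ be a nonzero integer, written as $n=2^j\cdot m$ with $j\ge 0$ an integer and $m$ odd, and let $i$ be an integer with $j<i$. Then $$f(n,i) = f(n-2^j,i) + f(n+2^j,i).$$
   Context: For an integer $n$ and an integer $i\ge 0$, $f(n,i)$ denotes the number of binary signed-digit (BSD) representations of $n$ on $i$ bits, i.e. the number of tuples $(b_{i-1},\dots,b_0)\in\{1,0,-1\}^i$ with $n=\sum_{j=0}^{i-1} b_j 2^j$. -}

module Defs where

open import Data.Nat using (ℕ; zero; suc)
open import Data.Integer using (ℤ; +_; -[1+_]; _+_; _*_)
open import Data.List using (List; []; _∷_; map; concatMap; filter; length)
open import Data.Vec using (Vec; []; _∷_)
open import Relation.Binary.PropositionalEquality using (_≡_)
open import Data.Integer.Properties using (_≟_)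

data Digit : Set where
  d1 d0 d-1 : Digit

digitVal : Digit → ℤ
digitVal d1 = + 1
digitVal d0 = + 0
digitVal d-1 = -[1+ 0 ]

allDigits : List Digit
allDigits = d1 ∷ d0 ∷ d-1 ∷ []

-- Value of (b_{i-1}, …, b_0) stored least-significant first: b_0 ∷ b_1 ∷ … ,
-- i.e. value = Σ_j b_j 2^j.
value : ∀ {i} → Vec Digit i → ℤ
value [] = + 0
value (b ∷ bs) = digitVal b + (+ 2) * value bs

allTuples : (i : ℕ) → List (Vec Digit i)
allTuples zero = [] ∷ []
allTuples (suc i) = concatMap (λ b → map (b ∷_) (allTuples i)) allDigits

f : ℤ → ℕ → ℕ
f n i = length (filter (λ v → value v ≟ n) (allTuples i))

open import Data.Product using (∃)

OddInt : ℤ → Set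
OddInt m = ∃ λ (k : ℤ) → m ≡ (+ 2) * k + + 1

-- Splitting off the least significant digit b₀ turns a representation of n on i + 1 bits
-- into one of (n − b₀)/2 on i bits.  Hence f(2k, i+1) = f(k, i), since b₀ must be 0, and
-- f(2k+1, i+1) = f(k, i) + f(k+1, i), since b₀ = ±1.  For n = 2ʲm the first recurrence
-- strips j factors of 2 from n and n ± 2ʲ simultaneously; at j = 0, with m = 2k+1, the
-- second one together with the first gives f(2k+1) = f(2k) + f(2k+2).
module Submission where

open import Defs
open import Algebra.Bundles using (AbelianGroup)
open import Data.Nat as ℕ using (ℕ; zero; suc; s≤s)
open import Data.Nat.Divisibility using (divides; ∣1⇒≡1)
import Data.Nat.Properties as ℕ
open import Data.Integer using (ℤ; +_; _+_; _-_; _*_; _^_; ∣_∣)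
open import Data.Integer.Properties using (_≟_; +-identityˡ; +-0-abelianGroup; *-cancelˡ-≡; *-assoc; abs-*)
open import Data.Integer.Tactic.RingSolver using (solve-∀)
open import Data.List using (List; []; _∷_; _++_; map; concatMap; filter; length)
open import Data.Nat.ListAction using (sum)
open import Data.List.Properties using (filter-++; length-++; filter-≐; filter-none; map-cong)
open import Data.List.Relation.Unary.All using (universal)
open import Data.Product using (_,_)
open import Data.Vec using (_∷_)
open import Relation.Nullary using (yes; no)
open import Relation.Unary using (Pred; Decidable)
open import Relation.Binary.PropositionalEquality
  using (_≡_; _≢_; refl; sym; trans; cong; cong₂; module ≡-Reasoning)
open import Algebra.Properties.Group (AbelianGroup.group +-0-abelianGroup) using (∙-cancelˡ)

open ≡-Reasoning

module _ {a p} {A : Set a} {P : Pred A p} (P? : Decidable P) where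

  length-filter-++ : ∀ xs ys →
    length (filter P? (xs ++ ys)) ≡ length (filter P? xs) ℕ.+ length (filter P? ys)
  length-filter-++ xs ys = trans (cong length (filter-++ P? xs ys)) (length-++ (filter P? xs))

  length-filter-concatMap : ∀ {b} {B : Set b} (g : B → List A) (ys : List B) →
    length (filter P? (concatMap g ys)) ≡ sum (map (λ y → length (filter P? (g y))) ys)
  length-filter-concatMap g []       = refl
  length-filter-concatMap g (y ∷ ys) =
    trans (length-filter-++ (g y) (concatMap g ys))
          (cong (length (filter P? (g y)) ℕ.+_) (length-filter-concatMap g ys))

  length-filter-map : ∀ {b} {B : Set b} (g : B → A) (xs : List B) →
    length (filter P? (map g xs)) ≡ length (filter (λ x → P? (g x)) xs)
  length-filter-map g []       = refl
  length-filter-map g (x ∷ xs) with P? (g x)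
  ... | yes _ = cong suc (length-filter-map g xs)
  ... | no _  = length-filter-map g xs

two∤one : ∀ c → + 1 ≢ + 2 * c
two∤one c eq with ∣1⇒≡1 (divides ∣ c ∣ (begin
  ∣ + 1 ∣       ≡⟨ cong ∣_∣ eq ⟩
  ∣ + 2 * c ∣   ≡⟨ abs-* (+ 2) c ⟩
  2 ℕ.* ∣ c ∣   ≡⟨ ℕ.*-comm 2 ∣ c ∣ ⟩
  ∣ c ∣ ℕ.* 2   ∎))
... | ()

odd≢even : ∀ a b → + 1 + + 2 * a ≢ + 2 * b
odd≢even a b eq = two∤one (b - a) (begin
  + 1                         ≡⟨ cancel a ⟩
  (+ 1 + + 2 * a) - + 2 * a   ≡⟨ cong (_- + 2 * a) eq ⟩
  + 2 * b - + 2 * a           ≡⟨ factor b a ⟩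
  + 2 * (b - a)               ∎)
  where
  cancel : ∀ a → + 1 ≡ (+ 1 + + 2 * a) - + 2 * a
  cancel = solve-∀
  factor : ∀ b a → + 2 * b - + 2 * a ≡ + 2 * (b - a)
  factor = solve-∀

lowDigitCount : Digit → ℤ → ℕ → ℕ
lowDigitCount b n i = length (filter (λ v → digitVal b + + 2 * value v ≟ n) (allTuples i))

f-suc : ∀ n i → f n (suc i) ≡ sum (map (λ b → lowDigitCount b n i) allDigits)
f-suc n i = begin
  f n (suc i)
    ≡⟨ length-filter-concatMap (λ v → value v ≟ n) (λ b → map (b ∷_) (allTuples i)) allDigits ⟩
  sum (map (λ b → length (filter (λ v → value v ≟ n) (map (b ∷_) (allTuples i)))) allDigits)
    ≡⟨ cong sum (map-cong (λ b → length-filter-map (λ v → value v ≟ n) (b ∷_) (allTuples i)) allDigits) ⟩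
  sum (map (λ b → lowDigitCount b n i) allDigits) ∎

lowDigitCount-≡-f : ∀ b k i {n} → n ≡ digitVal b + + 2 * k → lowDigitCount b n i ≡ f k i
lowDigitCount-≡-f b k i refl = cong length (filter-≐ _ _ (halve , double) (allTuples i))
  where
  halve : ∀ {w} → digitVal b + + 2 * w ≡ digitVal b + + 2 * k → w ≡ k
  halve eq = *-cancelˡ-≡ (+ 2) _ _ (∙-cancelˡ (digitVal b) _ _ eq)
  double : ∀ {w} → w ≡ k → digitVal b + + 2 * w ≡ digitVal b + + 2 * k
  double = cong (λ w → digitVal b + + 2 * w)

lowDigitCount-≡-0 : ∀ b n i → (∀ w → digitVal b + + 2 * w ≢ n) → lowDigitCount b n i ≡ 0
lowDigitCount-≡-0 b n i miss =
  cong length (filter-none _ (universal (λ v → miss (value v)) (allTuples i)))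

f-even : ∀ k i → f (+ 2 * k) (suc i) ≡ f k i
f-even k i = begin
  f (+ 2 * k) (suc i)                                     ≡⟨ f-suc (+ 2 * k) i ⟩
  count d1 ℕ.+ (count d0 ℕ.+ (count d-1 ℕ.+ 0))           ≡⟨ cong₂ ℕ._+_ d1-none
                                                               (cong₂ ℕ._+_ d0-count (cong (ℕ._+ 0) d-1-none)) ⟩
  f k i ℕ.+ 0                                             ≡⟨ ℕ.+-identityʳ (f k i) ⟩
  f k i                                                   ∎
  where
  count : Digit → ℕ
  count b = lowDigitCount b (+ 2 * k) i
  d1-none : count d1 ≡ 0
  d1-none = lowDigitCount-≡-0 d1 _ i (λ w → odd≢even w k)
  d0-count : count d0 ≡ f k i
  d0-count = lowDigitCount-≡-f d0 k i (sym (+-identityˡ (+ 2 * k)))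
  d-1-none : count d-1 ≡ 0
  d-1-none = lowDigitCount-≡-0 d-1 _ i (λ w eq → odd≢even (w - + 1) k (trans (shift w) eq))
    where
    shift : ∀ w → + 1 + + 2 * (w - + 1) ≡ digitVal d-1 + + 2 * w
    shift = solve-∀

f-odd : ∀ k i → f (+ 1 + + 2 * k) (suc i) ≡ f k i ℕ.+ f (k + + 1) i
f-odd k i = begin
  f (+ 1 + + 2 * k) (suc i)                               ≡⟨ f-suc (+ 1 + + 2 * k) i ⟩
  count d1 ℕ.+ (count d0 ℕ.+ (count d-1 ℕ.+ 0))           ≡⟨ cong₂ ℕ._+_ d1-count
                                                               (cong₂ ℕ._+_ d0-none d-1-count) ⟩
  f k i ℕ.+ (f (k + + 1) i ℕ.+ 0)                         ≡⟨ cong (f k i ℕ.+_) (ℕ.+-identityʳ _) ⟩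
  f k i ℕ.+ f (k + + 1) i                                 ∎
  where
  count : Digit → ℕ
  count b = lowDigitCount b (+ 1 + + 2 * k) i
  d1-count : count d1 ≡ f k i
  d1-count = lowDigitCount-≡-f d1 k i refl
  d0-none : count d0 ≡ 0
  d0-none = lowDigitCount-≡-0 d0 _ i
    (λ w eq → odd≢even k w (sym (trans (sym (+-identityˡ (+ 2 * w))) eq)))
  d-1-count : count d-1 ℕ.+ 0 ≡ f (k + + 1) i ℕ.+ 0
  d-1-count = cong (ℕ._+ 0) (lowDigitCount-≡-f d-1 (k + + 1) i (shift k))
    where
    shift : ∀ k → + 1 + + 2 * k ≡ digitVal d-1 + + 2 * (k + + 1)
    shift = solve-∀

f-split : ∀ j m → OddInt m → ∀ i → j ℕ.< i →
  f ((+ 2) ^ j * m) i ≡ f ((+ 2) ^ j * m - (+ 2) ^ j) i ℕ.+ f ((+ 2) ^ j * m + (+ 2) ^ j) i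
f-split zero m (k , refl) (suc i) _ = begin
  f (+ 1 * (+ 2 * k + + 1)) (suc i)                        ≡⟨ cong (λ n → f n (suc i)) (odd k) ⟩
  f (+ 1 + + 2 * k) (suc i)                                ≡⟨ f-odd k i ⟩
  f k i ℕ.+ f (k + + 1) i
    ≡⟨ sym (cong₂ ℕ._+_ (f-even k i) (f-even (k + + 1) i)) ⟩
  f (+ 2 * k) (suc i) ℕ.+ f (+ 2 * (k + + 1)) (suc i)
    ≡⟨ cong₂ (λ x y → f x (suc i) ℕ.+ f y (suc i)) (below k) (above k) ⟩
  f (+ 1 * (+ 2 * k + + 1) - + 1) (suc i) ℕ.+ f (+ 1 * (+ 2 * k + + 1) + + 1) (suc i) ∎
  where
  odd : ∀ k → + 1 * (+ 2 * k + + 1) ≡ + 1 + + 2 * k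
  odd = solve-∀
  below : ∀ k → + 2 * k ≡ + 1 * (+ 2 * k + + 1) - + 1
  below = solve-∀
  above : ∀ k → + 2 * (k + + 1) ≡ + 1 * (+ 2 * k + + 1) + + 1
  above = solve-∀
f-split (suc j) m odd (suc i) (s≤s j<i) = begin
  f (+ 2 * p * m) (suc i)                                  ≡⟨ cong (λ n → f n (suc i)) (*-assoc (+ 2) p m) ⟩
  f (+ 2 * (p * m)) (suc i)                                ≡⟨ f-even (p * m) i ⟩
  f (p * m) i                                              ≡⟨ f-split j m odd i j<i ⟩
  f (p * m - p) i ℕ.+ f (p * m + p) i
    ≡⟨ sym (cong₂ ℕ._+_ (f-even (p * m - p) i) (f-even (p * m + p) i)) ⟩
  f (+ 2 * (p * m - p)) (suc i) ℕ.+ f (+ 2 * (p * m + p)) (suc i)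
    ≡⟨ cong₂ (λ x y → f x (suc i) ℕ.+ f y (suc i)) (below p m) (above p m) ⟩
  f (+ 2 * p * m - + 2 * p) (suc i) ℕ.+ f (+ 2 * p * m + + 2 * p) (suc i) ∎
  where
  p : ℤ
  p = (+ 2) ^ j
  below : ∀ p m → + 2 * (p * m - p) ≡ + 2 * p * m - + 2 * p
  below = solve-∀
  above : ∀ p m → + 2 * (p * m + p) ≡ + 2 * p * m + + 2 * p
  above = solve-∀

theorem6 : (n : ℤ) → n ≢ + 0 → (j : ℕ) (m : ℤ) → n ≡ (+ 2) ^ j * m → OddInt m →
    (i : ℕ) → j ℕ.< i →
    f n i ≡ f (n - (+ 2) ^ j) i ℕ.+ f (n + (+ 2) ^ j) i
-- n ≢ 0 is implied by m being odd.
theorem6 _ _ j m refl odd i j<i = f-split j m odd i j<i
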